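{- Let $\mathcal{X}$ and $\mathcal{Y}$ be any two paging algorithms with arbitrary cache sizes such that each only fetches a page when it is requested. Then for every request sequence $\sigma$, $C(\mathcal{X},\sigma)\le C(\mathcal{Y},\sigma)+B$, where $B$ is the number of bad evictions of $\mathcal{X}$ with respect to $\mathcal{Y}$ throughout $\sigma$.
   Context: Caches start empty. $C(\mathcal{X},\sigma)$ is the number of cache misses of $\mathcal{X}$ on $\sigma=\sigma_1\sigma_2\cdots$; $\mathcal{Y}(i)$ is the set of items cached by $\mathcal{Y}$ right after serving $\sigma_i$; $\textsf{Out}(\mathcal{X},\tau,x)$ is the set of items cached by $\mathcal{X}$ after $\tau$ but not after $\tau x$. An item $x$ is a bad eviction of $\mathcal{X}$ with respect to $\mathcal{Y}$ at time $i$ if $x\in\textsf{Out}(\mathcal{X},\sigma_1\cdots\sigma_{i-1},\sigma_i)\cap\mathcal{Y}(i)$, i.e., $x$ is evicted by $\mathcal{X}$ due to access $\sigma_i$ while $x$ is in $\mathcal{Y}$'s cache after $\sigma_i$. $B$ counts all pairs (time, item) that are bad evictions (an algorithm may evict several items in one step). -}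

module Defs where

open import Data.Nat using (ℕ; zero; suc; _+_; _≤_)
open import Data.Fin using (Fin)
open import Data.Fin.Subset using (Subset; ⊥; _∈_; _∩_; _─_; ∣_∣)
open import Data.Fin.Subset.Properties using (_∈?_)
open import Data.List using (List; []; _∷_; _∷ʳ_)
open import Data.Sum using (_⊎_)
open import Relation.Binary.PropositionalEquality using (_≡_)
open import Relation.Nullary using (yes; no)

-- Pages are drawn from the finite universe Fin n (any request sequence
-- uses only finitely many pages).  A (deterministic) paging algorithm is
-- given by the set of items it caches after serving each request sequence
-- τ (a prefix of the input), i.e. cache τ = 𝒳 after τ.
record PagingAlgorithm (n : ℕ) : Set where
  field
    cacheSize : ℕ
    cache     : List (Fin n) → Subset n
    startsEmpty : cache [] ≡ ⊥
    withinSize  : ∀ τ → ∣ cache τ ∣ ≤ cacheSize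
    serves      : ∀ τ x → x ∈ cache (τ ∷ʳ x)
open PagingAlgorithm public

FetchesOnlyOnRequest : ∀ {n} → PagingAlgorithm n → Set
FetchesOnlyOnRequest 𝒳 =
  ∀ τ x y → y ∈ cache 𝒳 (τ ∷ʳ x) → y ∈ cache 𝒳 τ ⊎ y ≡ x

Out : ∀ {n} → PagingAlgorithm n → List (Fin n) → Fin n → Subset n
Out 𝒳 τ x = cache 𝒳 τ ─ cache 𝒳 (τ ∷ʳ x)

missesFrom : ∀ {n} → PagingAlgorithm n → List (Fin n) → List (Fin n) → ℕ
missesFrom 𝒳 τ [] = 0
missesFrom 𝒳 τ (x ∷ ρ) with x ∈? cache 𝒳 τ
... | yes _ = missesFrom 𝒳 (τ ∷ʳ x) ρ
... | no  _ = suc (missesFrom 𝒳 (τ ∷ʳ x) ρ)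

C : ∀ {n} → PagingAlgorithm n → List (Fin n) → ℕ
C 𝒳 σ = missesFrom 𝒳 [] σ

badFrom : ∀ {n} → PagingAlgorithm n → PagingAlgorithm n →
          List (Fin n) → List (Fin n) → ℕ
badFrom 𝒳 𝒴 τ [] = 0
badFrom 𝒳 𝒴 τ (x ∷ ρ) =
  ∣ Out 𝒳 τ x ∩ cache 𝒴 (τ ∷ʳ x) ∣ + badFrom 𝒳 𝒴 (τ ∷ʳ x) ρ

BadEvictions : ∀ {n} → PagingAlgorithm n → PagingAlgorithm n → List (Fin n) → ℕ
BadEvictions 𝒳 𝒴 σ = badFrom 𝒳 𝒴 [] σ

module Submission where

open import Defs
open import Data.Nat using (ℕ; _+_; _≤_; z≤n; s≤s)
open import Data.Nat.Properties
  using (≤-refl; ≤-trans; ≤-reflexive; n≤1+n; m≤n+m; +-suc; +-assoc; +-identityʳ; +-mono-≤; +-monoʳ-≤; module ≤-Reasoning)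
open import Data.Nat.Solver using (module +-*-Solver)
open import Data.Fin using (Fin)
open import Data.Fin.Subset
  using (Subset; inside; outside; ⊥; _∈_; _∉_; _∩_; _∪_; _─_; _-_; ∣_∣; _⊆_)
open import Data.Fin.Subset.Properties
  using (_∈?_; p⊆q⇒∣p∣≤∣q∣; x∈p⇒∣p-x∣<∣p∣; x∈p∪q⁺; x∈p∩q⁺; x∈p∧x∉q⇒x∈p─q;
         x∈p∧x≢y⇒x∈p-y; p─q⊆p; ∣p─q∣≤∣p∣; p─⊥≡p; ∣⊥∣≡0)
open import Data.List using (List; []; _∷_; _∷ʳ_)
open import Data.Vec using ([]; _∷_; here; there)
open import Data.Sum using (inj₁; inj₂)
open import Data.Product using (_,_)
open import Data.Empty using (⊥-elim)
open import Relation.Nullary using (Dec; yes; no; ¬_)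
open import Relation.Binary.PropositionalEquality using (_≡_; refl; sym; trans; cong)

-- The argument is amortised, with potential the number of items cached by 𝒴
-- but not by 𝒳.  When x is requested, a miss of 𝒳 that 𝒴 does not share is a
-- hit of 𝒴, so x leaves the potential; an item can only enter the potential
-- when 𝒳 evicts it while 𝒴 keeps it, i.e. through a bad eviction.  So the
-- misses of 𝒳 plus the increase of potential are bounded by the misses of 𝒴
-- plus the bad evictions, and the potential starts at 0.

∣p∪q∣≤∣p∣+∣q∣ : ∀ {n} (p q : Subset n) → ∣ p ∪ q ∣ ≤ ∣ p ∣ + ∣ q ∣
∣p∪q∣≤∣p∣+∣q∣ []            []            = z≤n
∣p∪q∣≤∣p∣+∣q∣ (outside ∷ p) (outside ∷ q) = ∣p∪q∣≤∣p∣+∣q∣ p q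
∣p∪q∣≤∣p∣+∣q∣ (outside ∷ p) (inside  ∷ q) =
  ≤-trans (s≤s (∣p∪q∣≤∣p∣+∣q∣ p q)) (≤-reflexive (sym (+-suc ∣ p ∣ ∣ q ∣)))
∣p∪q∣≤∣p∣+∣q∣ (inside  ∷ p) (outside ∷ q) = s≤s (∣p∪q∣≤∣p∣+∣q∣ p q)
∣p∪q∣≤∣p∣+∣q∣ (inside  ∷ p) (inside  ∷ q) =
  s≤s (≤-trans (∣p∪q∣≤∣p∣+∣q∣ p q) (+-monoʳ-≤ ∣ p ∣ (n≤1+n ∣ q ∣)))

x∈p─q⇒x∉q : ∀ {n} {x : Fin n} (p q : Subset n) → x ∈ p ─ q → x ∉ q
x∈p─q⇒x∉q (_ ∷ p) (outside ∷ q) here      ()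
x∈p─q⇒x∉q (_ ∷ p) (inside  ∷ q) ()        here
x∈p─q⇒x∉q (_ ∷ p) (_       ∷ q) (there i) (there j) = x∈p─q⇒x∉q p q i j

missCost : ∀ {p} {P : Set p} → Dec P → ℕ
missCost (yes _) = 0
missCost (no  _) = 1

missesFrom-∷ : ∀ {n} (𝒳 : PagingAlgorithm n) τ x ρ →
               missesFrom 𝒳 τ (x ∷ ρ) ≡ missCost (x ∈? cache 𝒳 τ) + missesFrom 𝒳 (τ ∷ʳ x) ρ
missesFrom-∷ 𝒳 τ x ρ with x ∈? cache 𝒳 τ
... | yes _ = refl
... | no  _ = refl

module Amortised {n} (𝒳 𝒴 : PagingAlgorithm n) (𝒴-lazy : FetchesOnlyOnRequest 𝒴) where

  onlyInY : List (Fin n) → Subset n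
  onlyInY τ = cache 𝒴 τ ─ cache 𝒳 τ

  badAt : List (Fin n) → Fin n → Subset n
  badAt τ x = Out 𝒳 τ x ∩ cache 𝒴 (τ ∷ʳ x)

  onlyInY-step : ∀ τ x → onlyInY (τ ∷ʳ x) ⊆ (onlyInY τ - x) ∪ badAt τ x
  onlyInY-step τ x {y} y∈ with y ∈? cache 𝒳 τ
  ... | yes y∈𝒳τ = x∈p∪q⁺ (inj₂ (x∈p∩q⁺ (x∈p∧x∉q⇒x∈p─q y∈𝒳τ y∉𝒳τx , y∈𝒴τx)))
    where
    y∈𝒴τx = p─q⊆p _ _ y∈
    y∉𝒳τx = x∈p─q⇒x∉q (cache 𝒴 (τ ∷ʳ x)) _ y∈
  ... | no  y∉𝒳τ = x∈p∪q⁺ (inj₁ (x∈p∧x≢y⇒x∈p-y (x∈p∧x∉q⇒x∈p─q y∈𝒴τ y∉𝒳τ) y≢x))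
    where
    y≢x : ¬ y ≡ x
    y≢x refl = x∈p─q⇒x∉q (cache 𝒴 (τ ∷ʳ x)) _ y∈ (serves 𝒳 τ x)
    y∈𝒴τ : y ∈ cache 𝒴 τ
    y∈𝒴τ with 𝒴-lazy τ x y (p─q⊆p _ _ y∈)
    ... | inj₁ y∈𝒴τ = y∈𝒴τ
    ... | inj₂ y≡x  = ⊥-elim (y≢x y≡x)

  ∣onlyInY-step∣ : ∀ τ x → ∣ onlyInY (τ ∷ʳ x) ∣ ≤ ∣ onlyInY τ - x ∣ + ∣ badAt τ x ∣
  ∣onlyInY-step∣ τ x =
    ≤-trans (p⊆q⇒∣p∣≤∣q∣ (onlyInY-step τ x)) (∣p∪q∣≤∣p∣+∣q∣ (onlyInY τ - x) (badAt τ x))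

  removeRequest : ∀ τ x →
    missCost (x ∈? cache 𝒳 τ) + ∣ onlyInY τ - x ∣ ≤ missCost (x ∈? cache 𝒴 τ) + ∣ onlyInY τ ∣
  removeRequest τ x with x ∈? cache 𝒳 τ | x ∈? cache 𝒴 τ
  ... | yes _    | x∈?𝒴τ    = ≤-trans (∣p─q∣≤∣p∣ (onlyInY τ) _) (m≤n+m _ (missCost x∈?𝒴τ))
  ... | no  _    | no  _    = s≤s (∣p─q∣≤∣p∣ (onlyInY τ) _)
  ... | no  x∉𝒳τ | yes x∈𝒴τ = x∈p⇒∣p-x∣<∣p∣ (x∈p∧x∉q⇒x∈p─q x∈𝒴τ x∉𝒳τ)

  amortisedStep : ∀ τ x →
    missCost (x ∈? cache 𝒳 τ) + ∣ onlyInY (τ ∷ʳ x) ∣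
      ≤ missCost (x ∈? cache 𝒴 τ) + ∣ badAt τ x ∣ + ∣ onlyInY τ ∣
  amortisedStep τ x = begin
    cX + ∣ onlyInY (τ ∷ʳ x) ∣      ≤⟨ +-monoʳ-≤ cX (∣onlyInY-step∣ τ x) ⟩
    cX + (∣ onlyInY τ - x ∣ + b)   ≡⟨ sym (+-assoc cX _ b) ⟩
    cX + ∣ onlyInY τ - x ∣ + b     ≤⟨ +-mono-≤ (removeRequest τ x) ≤-refl ⟩
    cY + ∣ onlyInY τ ∣ + b         ≡⟨ swap cY _ b ⟩
    cY + b + ∣ onlyInY τ ∣         ∎
    where
    open ≤-Reasoning
    open +-*-Solver
    cX = missCost (x ∈? cache 𝒳 τ)
    cY = missCost (x ∈? cache 𝒴 τ)
    b  = ∣ badAt τ x ∣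
    swap : ∀ a c d → a + c + d ≡ a + d + c
    swap = solve 3 (λ a c d → a :+ c :+ d := a :+ d :+ c) refl

  missesFrom-bound : ∀ τ ρ →
    missesFrom 𝒳 τ ρ ≤ missesFrom 𝒴 τ ρ + badFrom 𝒳 𝒴 τ ρ + ∣ onlyInY τ ∣
  missesFrom-bound τ []      = z≤n
  missesFrom-bound τ (x ∷ ρ) = begin
    missesFrom 𝒳 τ (x ∷ ρ)                   ≡⟨ missesFrom-∷ 𝒳 τ x ρ ⟩
    cX + missesFrom 𝒳 τx ρ                   ≤⟨ +-monoʳ-≤ cX (missesFrom-bound τx ρ) ⟩
    cX + (Y′ + B′ + ∣ onlyInY τx ∣)          ≡⟨ shuffle cX Y′ B′ _ ⟩
    Y′ + B′ + (cX + ∣ onlyInY τx ∣)          ≤⟨ +-monoʳ-≤ (Y′ + B′) (amortisedStep τ x) ⟩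
    Y′ + B′ + (cY + b + ∣ onlyInY τ ∣)       ≡⟨ regroup Y′ B′ cY b _ ⟩
    cY + Y′ + (b + B′) + ∣ onlyInY τ ∣       ≡⟨ cong (λ m → m + (b + B′) + ∣ onlyInY τ ∣) (sym (missesFrom-∷ 𝒴 τ x ρ)) ⟩
    missesFrom 𝒴 τ (x ∷ ρ) + badFrom 𝒳 𝒴 τ (x ∷ ρ) + ∣ onlyInY τ ∣ ∎
    where
    open ≤-Reasoning
    open +-*-Solver
    τx = τ ∷ʳ x
    cX = missCost (x ∈? cache 𝒳 τ)
    cY = missCost (x ∈? cache 𝒴 τ)
    b  = ∣ badAt τ x ∣
    Y′ = missesFrom 𝒴 τx ρ
    B′ = badFrom 𝒳 𝒴 τx ρ
    shuffle : ∀ c y d p → c + (y + d + p) ≡ y + d + (c + p)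
    shuffle = solve 4 (λ c y d p → c :+ (y :+ d :+ p) := y :+ d :+ (c :+ p)) refl
    regroup : ∀ y d c e p → y + d + (c + e + p) ≡ c + y + (e + d) + p
    regroup = solve 5 (λ y d c e p → y :+ d :+ (c :+ e :+ p) := c :+ y :+ (e :+ d) :+ p) refl

  ∣onlyInY[]∣≡0 : ∣ onlyInY [] ∣ ≡ 0
  ∣onlyInY[]∣≡0 rewrite startsEmpty 𝒳 | startsEmpty 𝒴 = trans (cong ∣_∣ (p─⊥≡p (⊥ {n}))) (∣⊥∣≡0 n)

lemma6 : ∀ {n} (𝒳 𝒴 : PagingAlgorithm n) →
         FetchesOnlyOnRequest 𝒳 → FetchesOnlyOnRequest 𝒴 →
         (σ : List (Fin n)) →
         C 𝒳 σ ≤ C 𝒴 σ + BadEvictions 𝒳 𝒴 σ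
lemma6 𝒳 𝒴 _ 𝒴-lazy σ = begin
  C 𝒳 σ                                          ≤⟨ missesFrom-bound [] σ ⟩
  C 𝒴 σ + BadEvictions 𝒳 𝒴 σ + ∣ onlyInY [] ∣    ≡⟨ cong (C 𝒴 σ + BadEvictions 𝒳 𝒴 σ +_) ∣onlyInY[]∣≡0 ⟩
  C 𝒴 σ + BadEvictions 𝒳 𝒴 σ + 0                ≡⟨ +-identityʳ (C 𝒴 σ + BadEvictions 𝒳 𝒴 σ) ⟩
  C 𝒴 σ + BadEvictions 𝒳 𝒴 σ                    ∎
  where
  open ≤-Reasoning
  open Amortised 𝒳 𝒴 𝒴-lazy
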